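{- Let $n\ge2$ and let $A=\{a_1,\ldots,a_n\}$ be integers with $0=a_1<a_2<\cdots<a_n$. For an integer $k\ge0$ let $b(k)$ be the number of $A$-expansions of $k$. Let $c_i=1$ if $i\in A$ and $c_i=0$ otherwise, and let $S$ be the operator on bounded sequences $g=(g_i)_{i\in\mathbb{Z}}$ given by $(Sg)_k=\sum_{i\in\mathbb{Z}}c_{k-ni}g_i$. Let $\delta$ be the sequence with $\delta_0=1$ and $\delta_k=0$ for $k\ne0$. Then for every $j\ge1$, $$b(k)=(S^j\delta)_k,\qquad k=0,\ldots,n^j-1.$$
   Context: For an integer $k\ge 0$, an $A$-expansion of $k$ is a tuple $(\alpha_0,\ldots,\alpha_J)$ of elements of $A$ with $k=\sum_{j=0}^J\alpha_jn^j$ and $\alpha_J\ne0$; for $k=0$ the empty tuple is its $A$-expansion. -}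

module Defs where

open import Data.Nat as ℕ using (ℕ; zero; suc; _+_; _*_; _^_; _<_; _⊔_)
open import Data.Integer as ℤ using (ℤ; +_; -[1+_]; ∣_∣)
open import Data.Fin using (Fin)
open import Data.Fin.Properties using (any?)
open import Data.Product using (Σ; ∃; ∃-syntax; _×_; _,_)
open import Data.Sum using (_⊎_)
open import Data.List using (List; []; _∷_; _∷ʳ_; length)
open import Data.List.Relation.Unary.All using (All)
open import Data.List.Relation.Unary.Unique.Propositional using (Unique)
open import Data.List.Membership.Propositional using (_∈_)
open import Data.Vec.Functional using (foldr)
open import Function.Bundles using (_⇔_)
open import Relation.Nullary using (¬_; yes; no)
open import Relation.Binary.PropositionalEquality using (_≡_)

-- The digit set A = {a 0, …, a (n-1)} ⊆ ℕ (0-indexed: a 0 is the paper's a₁).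
_∈A_ : {n : ℕ} → ℕ → (Fin n → ℕ) → Set
m ∈A a = ∃[ i ] a i ≡ m

valFrom : ℕ → ℕ → List ℕ → ℕ
valFrom n j []       = 0
valFrom n j (x ∷ xs) = x * n ^ j + valFrom n (suc j) xs

val : ℕ → List ℕ → ℕ
val n = valFrom n 0

LastNonzero : List ℕ → Set
LastNonzero t = t ≡ [] ⊎ ∃[ init ] ∃[ α ] (t ≡ init ∷ʳ α × ¬ α ≡ 0)

IsExpansion : (n : ℕ) → (Fin n → ℕ) → ℕ → List ℕ → Set
IsExpansion n a k t = All (λ α → α ∈A a) t × val n t ≡ k × LastNonzero t

-- "P has exactly m elements": a duplicate-free list of length m listing exactly P
HasCard : {X : Set} → (X → Set) → ℕ → Set
HasCard {X} P m = Σ (List X) λ L → Unique L × (∀ x → (x ∈ L) ⇔ P x) × length L ≡ m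

c : {n : ℕ} → (Fin n → ℕ) → ℤ → ℤ
c a -[1+ _ ] = + 0
c a (+ m) with any? (λ i → a i ℕ.≟ m)
... | yes _ = + 1
... | no  _ = + 0

sumFrom : ℤ → ℕ → (ℤ → ℤ) → ℤ
sumFrom lo zero    f = + 0
sumFrom lo (suc m) f = f lo ℤ.+ sumFrom (lo ℤ.+ + 1) m f

sumWindow : ℕ → (ℤ → ℤ) → ℤ
sumWindow B f = sumFrom (ℤ.- (+ B)) (suc (2 * B)) f

maxA : {n : ℕ} → (Fin n → ℕ) → ℕ
maxA a = foldr _⊔_ 0 a

-- (S g)_k = Σ_{i ∈ ℤ} c_{k - n i} g_i.  All nonzero terms have |i| ≤ |k| + max A,
-- so the sum over ℤ equals the finite sum over that window.
S : (n : ℕ) → (Fin n → ℕ) → (ℤ → ℤ) → (ℤ → ℤ)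
S n a g k = sumWindow (∣ k ∣ + maxA a) (λ i → c a (k ℤ.- (+ n) ℤ.* i) ℤ.* g i)

iter : {X : Set} → ℕ → (X → X) → X → X
iter zero    f x = x
iter (suc j) f x = f (iter j f x)

δ : ℤ → ℤ
δ (+ zero) = + 1
δ _        = + 0

-- Let b_j(k) count the A-expansions of k with at most j digits.  Splitting off the
-- first digit α of an expansion of k > 0 writes k = α + n i with α ∈ A, followed by
-- an expansion of i with one digit fewer, so b_{j+1}(k) = Σ_i c_{k - n i} b_j(i):
-- the recursion of S^{j+1} δ, whose terms vanish at negative indices.  At k = 0 both
-- sides are 1 because 0 ∈ A, and b_0 = δ on ℕ; hence (S^j δ)_k = b_j(k).  Finally an
-- expansion of k < n^j has at most j digits, so b_j(k) = b(k).
module Submission where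

open import Defs
open import Data.Nat using (ℕ; _<_; _≤_; _^_)
open import Data.Integer using (+_)
open import Data.Fin using (Fin; toℕ)
open import Data.List using (List)
open import Data.Product using (Σ; _×_)
open import Relation.Binary.PropositionalEquality using (_≡_)

open import Data.Nat using (zero; suc; _+_; _*_; _∸_; z≤n; s≤s; _≤?_; _≟_; NonZero)
open import Data.Nat.Properties
open import Algebra.Properties.CommutativeSemigroup *-commutativeSemigroup using (x∙yz≈y∙xz)
open import Data.Integer as ℤ using (ℤ; -[1+_]; _⊖_)
import Data.Integer.Properties as ℤ
import Data.Fin as Fin
open import Data.Fin.Properties using (any?)
open import Data.List using ([]; _∷_; _++_; map; length; _∷ʳ_)
open import Data.List.Properties using (length-++; length-map; ∷-injectiveʳ)
open import Data.List.Relation.Unary.All using (All; []; _∷_)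
open import Data.List.Relation.Unary.Any using (here)
open import Data.List.Membership.Propositional using (_∈_)
open import Data.List.Membership.Propositional.Properties
  using (∈-map⁺; ∈-map⁻; ∈-++⁻; ∈-++⁺ˡ; ∈-++⁺ʳ)
open import Data.List.Relation.Unary.Unique.Propositional using (Unique; []; _∷_)
import Data.List.Relation.Unary.Unique.Propositional.Properties as Unique
open import Data.Product using (_,_; proj₁; proj₂)
open import Data.Sum using (inj₁; inj₂)
open import Data.Unit using (⊤; tt)
open import Function.Bundles using (_⇔_; mk⇔; Equivalence)
open import Relation.Nullary using (¬_; yes; no; Dec; contradiction)
open import Relation.Nullary.Decidable using (_×-dec_)
open import Relation.Binary.PropositionalEquality
  using (refl; sym; trans; cong; cong₂; subst; module ≡-Reasoning)

sumRange : ℕ → ℕ → (ℕ → ℕ) → ℕ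
sumRange s zero    f = 0
sumRange s (suc m) f = f s + sumRange (s + 1) m f

sumRange-cong : ∀ s m {f g : ℕ → ℕ} → (∀ i → f i ≡ g i) → sumRange s m f ≡ sumRange s m g
sumRange-cong s zero    f≗g = refl
sumRange-cong s (suc m) f≗g = cong₂ _+_ (f≗g s) (sumRange-cong (s + 1) m f≗g)

sumRange-++ : ∀ s m r f → sumRange s (m + r) f ≡ sumRange s m f + sumRange (s + m) r f
sumRange-++ s zero    r f = cong (λ t → sumRange t r f) (sym (+-identityʳ s))
sumRange-++ s (suc m) r f = begin
  f s + sumRange (s + 1) (m + r) f
    ≡⟨ cong (λ x → f s + x) (sumRange-++ (s + 1) m r f) ⟩
  f s + (sumRange (s + 1) m f + sumRange (s + 1 + m) r f)
    ≡⟨ sym (+-assoc (f s) _ _) ⟩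
  sumRange s (suc m) f + sumRange (s + 1 + m) r f
    ≡⟨ cong (λ t → sumRange s (suc m) f + sumRange t r f) (+-assoc s 1 m) ⟩
  sumRange s (suc m) f + sumRange (s + suc m) r f ∎
  where open ≡-Reasoning

sumRange-vanishing : ∀ s m f → (∀ i → s ≤ i → f i ≡ 0) → sumRange s m f ≡ 0
sumRange-vanishing s zero    f f≡0 = refl
sumRange-vanishing s (suc m) f f≡0 =
  cong₂ _+_ (f≡0 s ≤-refl)
            (sumRange-vanishing (s + 1) m f (λ i s+1≤i → f≡0 i (≤-trans (m≤m+n s 1) s+1≤i)))

sumFrom-+ : (F : ℤ → ℤ) (f : ℕ → ℕ) → (∀ i → F (+ i) ≡ + f i) →
            ∀ s m → sumFrom (+ s) m F ≡ + sumRange s m f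
sumFrom-+ F f F≡f s zero    = refl
sumFrom-+ F f F≡f s (suc m) = cong₂ ℤ._+_ (F≡f s) (sumFrom-+ F f F≡f (s + 1) m)

sumFrom-vanishing : (F : ℤ → ℤ) → (∀ i → F i ≡ + 0) → ∀ lo m → sumFrom lo m F ≡ + 0
sumFrom-vanishing F F≡0 lo zero    = refl
sumFrom-vanishing F F≡0 lo (suc m) = cong₂ ℤ._+_ (F≡0 lo) (sumFrom-vanishing F F≡0 (lo ℤ.+ + 1) m)

sumFrom-drop-negatives : (F : ℤ → ℤ) → (∀ q → F -[1+ q ] ≡ + 0) →
                         ∀ p m → sumFrom -[1+ p ] (suc p + m) F ≡ sumFrom (+ 0) m F
sumFrom-drop-negatives F F≡0 zero    m =
  trans (cong (ℤ._+ sumFrom (+ 0) m F) (F≡0 0)) (ℤ.+-identityˡ _)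
sumFrom-drop-negatives F F≡0 (suc p) m =
  trans (cong (ℤ._+ sumFrom -[1+ p ] (suc p + m) F) (F≡0 (suc p)))
        (trans (ℤ.+-identityˡ _) (sumFrom-drop-negatives F F≡0 p m))

sumWindow-onℕ : (F : ℤ → ℤ) → (∀ q → F -[1+ q ] ≡ + 0) →
                ∀ B → sumWindow B F ≡ sumFrom (+ 0) (suc B) F
sumWindow-onℕ F F≡0 zero    = refl
sumWindow-onℕ F F≡0 (suc p) = begin
  sumFrom -[1+ p ] (suc (2 * suc p)) F    ≡⟨ cong (λ m → sumFrom -[1+ p ] m F) length≡ ⟩
  sumFrom -[1+ p ] (suc p + suc (suc p)) F ≡⟨ sumFrom-drop-negatives F F≡0 p (suc (suc p)) ⟩
  sumFrom (+ 0) (suc (suc p)) F           ∎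
  where
  open ≡-Reasoning
  length≡ : suc (2 * suc p) ≡ suc p + suc (suc p)
  length≡ = trans (cong (λ x → suc (suc p + x)) (+-identityʳ (suc p))) (sym (+-suc (suc p) (suc p)))

concatRange : {X : Set} → (ℕ → List X) → ℕ → ℕ → List X
concatRange g s zero    = []
concatRange g s (suc m) = g s ++ concatRange g (s + 1) m

module _ {X : Set} (g : ℕ → List X) where

  length-concatRange : ∀ s m → length (concatRange g s m) ≡ sumRange s m (λ i → length (g i))
  length-concatRange s zero    = refl
  length-concatRange s (suc m) =
    trans (length-++ (g s)) (cong (λ r → length (g s) + r) (length-concatRange (s + 1) m))

  ∈-concatRange⁻ : ∀ s m {x} → x ∈ concatRange g s m → Σ ℕ λ i → s ≤ i × x ∈ g i
  ∈-concatRange⁻ s (suc m) x∈ with ∈-++⁻ (g s) x∈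
  ... | inj₁ x∈gs = s , ≤-refl , x∈gs
  ... | inj₂ x∈rest with ∈-concatRange⁻ (s + 1) m x∈rest
  ...   | i , s+1≤i , x∈gi = i , ≤-trans (m≤m+n s 1) s+1≤i , x∈gi

  ∈-concatRange⁺ : ∀ s d m {x} → d < m → x ∈ g (s + d) → x ∈ concatRange g s m
  ∈-concatRange⁺ s zero    (suc m) {x} _         x∈ =
    ∈-++⁺ˡ (subst (λ i → x ∈ g i) (+-identityʳ s) x∈)
  ∈-concatRange⁺ s (suc d) (suc m) {x} (s≤s d<m) x∈ =
    ∈-++⁺ʳ (g s) (∈-concatRange⁺ (s + 1) d m d<m (subst (λ i → x ∈ g i) (sym (+-assoc s 1 d)) x∈))

  concatRange-unique : (index : X → ℕ) → (∀ i {x} → x ∈ g i → index x ≡ i) →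
                       (∀ i → Unique (g i)) → ∀ s m → Unique (concatRange g s m)
  concatRange-unique index index-correct unique-g s zero    = []
  concatRange-unique index index-correct unique-g s (suc m) =
    Unique.++⁺ (unique-g s) (concatRange-unique index index-correct unique-g (s + 1) m) disjoint
    where
    disjoint : ∀ {x} → ¬ (x ∈ g s × x ∈ concatRange g (s + 1) m)
    disjoint (x∈gs , x∈rest) with ∈-concatRange⁻ (s + 1) m x∈rest
    ... | i , s+1≤i , x∈gi =
      <-irrefl (sym (trans (sym (index-correct i x∈gi)) (index-correct s x∈gs)))
               (subst (_≤ i) (+-comm s 1) s+1≤i)

EndsNonzero : List ℕ → Set
EndsNonzero []          = ⊤
EndsNonzero (x ∷ [])    = ¬ x ≡ 0
EndsNonzero (_ ∷ y ∷ t) = EndsNonzero (y ∷ t)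

EndsNonzero-tail : ∀ x t → EndsNonzero (x ∷ t) → EndsNonzero t
EndsNonzero-tail x []      _ = tt
EndsNonzero-tail x (y ∷ t) e = e

EndsNonzero-∷ʳ : ∀ t {α} → ¬ α ≡ 0 → EndsNonzero (t ∷ʳ α)
EndsNonzero-∷ʳ []          α≢0 = α≢0
EndsNonzero-∷ʳ (x ∷ [])    α≢0 = α≢0
EndsNonzero-∷ʳ (x ∷ y ∷ t) α≢0 = EndsNonzero-∷ʳ (y ∷ t) α≢0

EndsNonzero⇒LastNonzero : ∀ t → EndsNonzero t → LastNonzero t
EndsNonzero⇒LastNonzero []          _ = inj₁ refl
EndsNonzero⇒LastNonzero (x ∷ [])    e = inj₂ ([] , x , refl , e)
EndsNonzero⇒LastNonzero (x ∷ y ∷ t) e with EndsNonzero⇒LastNonzero (y ∷ t) e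
... | inj₂ (init , α , y∷t≡init∷ʳα , α≢0) =
  inj₂ (x ∷ init , α , cong (x ∷_) y∷t≡init∷ʳα , α≢0)

LastNonzero⇔EndsNonzero : ∀ t → LastNonzero t ⇔ EndsNonzero t
LastNonzero⇔EndsNonzero t = mk⇔ to (EndsNonzero⇒LastNonzero t)
  where
  to : LastNonzero t → EndsNonzero t
  to (inj₁ refl)                    = tt
  to (inj₂ (init , α , refl , α≢0)) = EndsNonzero-∷ʳ init α≢0

valFrom-suc : ∀ n j t → valFrom n (suc j) t ≡ n * valFrom n j t
valFrom-suc n j []      = sym (*-zeroʳ n)
valFrom-suc n j (x ∷ t) = begin
  x * (n * n ^ j) + valFrom n (suc (suc j)) t
    ≡⟨ cong₂ _+_ (x∙yz≈y∙xz x n (n ^ j)) (valFrom-suc n (suc j) t) ⟩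
  n * (x * n ^ j) + n * valFrom n (suc j) t
    ≡⟨ *-distribˡ-+ n (x * n ^ j) _ ⟨
  n * (x * n ^ j + valFrom n (suc j) t)       ∎
  where open ≡-Reasoning

val-∷ : ∀ n x t → val n (x ∷ t) ≡ x + n * val n t
val-∷ n x t = cong₂ _+_ (*-identityʳ x) (valFrom-suc n 0 t)

EndsNonzero-∷ : ∀ n x t {k} → EndsNonzero t → val n (x ∷ t) ≡ suc k → EndsNonzero (x ∷ t)
EndsNonzero-∷ n x []      _ val≡ refl = 0≢1+n val≡
EndsNonzero-∷ n x (y ∷ t) e _         = e

m+n≡o⇒m≡o∸n : ∀ {m n o} → m + n ≡ o → m ≡ o ∸ n
m+n≡o⇒m≡o∸n {m} {n} refl = sym (m+n∸n≡m m n)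

module Expansions (n : ℕ) .{{_ : NonZero n}} (a : Fin n → ℕ) where

  digit? : ∀ m → Dec (m ∈A a)
  digit? m = any? (λ i → a i ≟ m)

  c-digit : ∀ {m} → m ∈A a → c a (+ m) ≡ + 1
  c-digit {m} m∈A with any? (λ i → a i ≟ m)
  ... | yes _ = refl
  ... | no m∉A = contradiction m∈A m∉A

  c-nondigit : ∀ {m} → ¬ m ∈A a → c a (+ m) ≡ + 0
  c-nondigit {m} m∉A with any? (λ i → a i ≟ m)
  ... | yes m∈A = contradiction m∈A m∉A
  ... | no _ = refl

  c-negative : ∀ {m} → 0 < m → c a (ℤ.- + m) ≡ + 0
  c-negative {suc m} _ = refl

  c-below-negative : ∀ q m → c a (-[1+ q ] ℤ.- + m) ≡ + 0
  c-below-negative q zero    = refl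
  c-below-negative q (suc m) = refl

  Step : ℕ → ℕ → Set
  Step k i = n * i ≤ k × (k ∸ n * i) ∈A a

  step? : ∀ k i → Dec (Step k i)
  step? k i = n * i ≤? k ×-dec digit? (k ∸ n * i)

  weight : ℕ → ℕ → ℕ
  weight k i with step? k i
  ... | yes _ = 1
  ... | no  _ = 0

  c-⊖ : ∀ k i → c a (k ⊖ n * i) ≡ + weight k i
  c-⊖ k i with step? k i
  ... | yes (ni≤k , d) = trans (cong (c a) (ℤ.⊖-≥ ni≤k)) (c-digit d)
  ... | no ¬step with n * i ≤? k
  ...   | yes ni≤k = trans (cong (c a) (ℤ.⊖-≥ ni≤k)) (c-nondigit (λ d → ¬step (ni≤k , d)))
  ...   | no ni≰k  = trans (cong (c a) (ℤ.⊖-< (≰⇒> ni≰k))) (c-negative (m<n⇒0<n∸m (≰⇒> ni≰k)))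

  c-weight : ∀ k i → c a (+ k ℤ.- + n ℤ.* + i) ≡ + weight k i
  c-weight k i = begin
    c a (+ k ℤ.- + n ℤ.* + i) ≡⟨ cong (λ x → c a (+ k ℤ.- x)) (ℤ.pos-* n i) ⟨
    c a (+ k ℤ.- + (n * i))   ≡⟨ cong (c a) (ℤ.m-n≡m⊖n k (n * i)) ⟩
    c a (k ⊖ n * i)           ≡⟨ c-⊖ k i ⟩
    + weight k i              ∎
    where open ≡-Reasoning

  weight-beyond : ∀ {k i} → k < i → weight k i ≡ 0
  weight-beyond {k} {i} k<i with step? k i
  ... | yes (ni≤k , _) = contradiction (≤-trans (m≤n*m i n) ni≤k) (<⇒≱ k<i)
  ... | no _ = refl

  weight-0-0 : 0 ∈A a → weight 0 0 ≡ 1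
  weight-0-0 0∈A with step? 0 0
  ... | yes _ = refl
  ... | no ¬step =
    contradiction (≤-reflexive (*-zeroʳ n) , subst (_∈A a) (sym (0∸n≡0 (n * 0))) 0∈A) ¬step

  S-onℕ : (g : ℤ → ℤ) (G : ℕ → ℕ) → (∀ q → g -[1+ q ] ≡ + 0) → (∀ i → g (+ i) ≡ + G i) →
          ∀ k → S n a g (+ k) ≡ + sumRange 0 (suc k) (λ i → weight k i * G i)
  S-onℕ g G g⁻≡0 g⁺≡G k = begin
    sumWindow (k + maxA a) F                     ≡⟨ sumWindow-onℕ F F⁻≡0 (k + maxA a) ⟩
    sumFrom (+ 0) (suc k + maxA a) F             ≡⟨ sumFrom-+ F f F⁺≡f 0 (suc k + maxA a) ⟩
    + sumRange 0 (suc k + maxA a) f              ≡⟨ cong +_ (sumRange-++ 0 (suc k) (maxA a) f) ⟩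
    + (sumRange 0 (suc k) f + sumRange (suc k) (maxA a) f)
      ≡⟨ cong (λ r → + (sumRange 0 (suc k) f + r)) (sumRange-vanishing (suc k) (maxA a) f f-beyond) ⟩
    + (sumRange 0 (suc k) f + 0)                 ≡⟨ cong +_ (+-identityʳ _) ⟩
    + sumRange 0 (suc k) f                       ∎
    where
    open ≡-Reasoning
    cₖ : ℤ → ℤ
    cₖ i = c a (+ k ℤ.- + n ℤ.* i)
    F : ℤ → ℤ
    F i = cₖ i ℤ.* g i
    f : ℕ → ℕ
    f i = weight k i * G i
    F⁻≡0 : ∀ q → F -[1+ q ] ≡ + 0
    F⁻≡0 q = trans (cong (cₖ -[1+ q ] ℤ.*_) (g⁻≡0 q)) (ℤ.*-zeroʳ (cₖ -[1+ q ]))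
    F⁺≡f : ∀ i → F (+ i) ≡ + f i
    F⁺≡f i = trans (cong₂ ℤ._*_ (c-weight k i) (g⁺≡G i)) (sym (ℤ.pos-* (weight k i) (G i)))
    f-beyond : ∀ i → suc k ≤ i → f i ≡ 0
    f-beyond i k<i = cong (_* G i) (weight-beyond k<i)

  S-negative : (g : ℤ → ℤ) → (∀ q → g -[1+ q ] ≡ + 0) → ∀ q → S n a g -[1+ q ] ≡ + 0
  S-negative g g⁻≡0 q = sumFrom-vanishing _ term≡0 (ℤ.- + B) (suc (2 * B))
    where
    B : ℕ
    B = suc q + maxA a
    c₋ : ℤ → ℤ
    c₋ i = c a (-[1+ q ] ℤ.- + n ℤ.* i)
    term≡0 : ∀ i → c₋ i ℤ.* g i ≡ + 0
    term≡0 -[1+ r ] = trans (cong (c₋ -[1+ r ] ℤ.*_) (g⁻≡0 r)) (ℤ.*-zeroʳ (c₋ -[1+ r ]))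
    term≡0 (+ i)    = trans (cong (λ x → c a (-[1+ q ] ℤ.- x) ℤ.* g (+ i)) (sym (ℤ.pos-* n i)))
                            (cong (ℤ._* g (+ i)) (c-below-negative q (n * i)))

  Expansion : ℕ → List ℕ → Set
  Expansion k t = All (_∈A a) t × val n t ≡ k × EndsNonzero t

  IsExpansion⇔Expansion : ∀ k t → IsExpansion n a k t ⇔ Expansion k t
  IsExpansion⇔Expansion k t = mk⇔
    (λ (digits , val≡ , last) → digits , val≡ , Equivalence.to (LastNonzero⇔EndsNonzero t) last)
    (λ (digits , val≡ , ends) → digits , val≡ , Equivalence.from (LastNonzero⇔EndsNonzero t) ends)

  val-positive : ∀ x t → EndsNonzero (x ∷ t) → 0 < val n (x ∷ t)
  val-positive x []      x≢0 = subst (0 <_) (sym (trans (+-identityʳ _) (*-identityʳ x))) (n≢0⇒n>0 x≢0)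
  val-positive x (y ∷ t) e   = subst (0 <_) (sym (val-∷ n x (y ∷ t)))
    (≤-trans (≤-trans (val-positive y t e) (m≤n*m _ n)) (m≤n+m _ x))

  val<n^j⇒length≤j : ∀ j t → EndsNonzero t → val n t < n ^ j → length t ≤ j
  val<n^j⇒length≤j j       []          _ _ = z≤n
  val<n^j⇒length≤j zero    (x ∷ t)     e v = contradiction (val-positive x t e) (<⇒≱ v)
  val<n^j⇒length≤j (suc j) (x ∷ [])    _ _ = s≤s z≤n
  val<n^j⇒length≤j (suc j) (x ∷ y ∷ t) e v = s≤s (val<n^j⇒length≤j j (y ∷ t) e
    (*-cancelˡ-< n _ _ (≤-<-trans (m≤n+m _ x) (subst (_< n ^ suc j) (val-∷ n x (y ∷ t)) v))))

  prefixDigit : (ℕ → List (List ℕ)) → ℕ → ℕ → List (List ℕ)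
  prefixDigit f k i with step? k i
  ... | yes _ = map ((k ∸ n * i) ∷_) (f i)
  ... | no  _ = []

  length-prefixDigit : ∀ f k i → length (prefixDigit f k i) ≡ weight k i * length (f i)
  length-prefixDigit f k i with step? k i
  ... | yes _ = trans (length-map _ (f i)) (sym (+-identityʳ _))
  ... | no  _ = refl

  ∈-prefixDigit⁻ : ∀ f k i {t} → t ∈ prefixDigit f k i →
                   Σ ℕ λ α → Σ (List ℕ) λ t′ → t ≡ α ∷ t′ × α + n * i ≡ k × α ∈A a × t′ ∈ f i
  ∈-prefixDigit⁻ f k i t∈ with step? k i
  ... | yes (ni≤k , α∈A) with ∈-map⁻ _ t∈
  ...   | t′ , t′∈ , refl = k ∸ n * i , t′ , refl , m∸n+n≡m ni≤k , α∈A , t′∈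

  ∈-prefixDigit⁺ : ∀ f k i {α t′} → α + n * i ≡ k → α ∈A a → t′ ∈ f i → α ∷ t′ ∈ prefixDigit f k i
  ∈-prefixDigit⁺ f k i {α} {t′} α+ni≡k α∈A t′∈ with step? k i
  ... | yes _    = subst (λ β → α ∷ t′ ∈ map (β ∷_) (f i)) (m+n≡o⇒m≡o∸n α+ni≡k) (∈-map⁺ (α ∷_) t′∈)
  ... | no ¬step = contradiction (subst (n * i ≤_) α+ni≡k (m≤n+m _ α) ,
                                  subst (_∈A a) (m+n≡o⇒m≡o∸n α+ni≡k) α∈A) ¬step

  prefixDigit-unique : ∀ f k i → Unique (f i) → Unique (prefixDigit f k i)
  prefixDigit-unique f k i unique with step? k i
  ... | yes _ = Unique.map⁺ ∷-injectiveʳ unique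
  ... | no  _ = []

  -- the A-expansions of k with at most j digits; the only expansion of 0 is empty
  expansions : ℕ → ℕ → List (List ℕ)
  expansions j       zero    = [] ∷ []
  expansions zero    (suc k) = []
  expansions (suc j) (suc k) = concatRange (prefixDigit (expansions j) (suc k)) 0 (suc (suc k))

  expansions-sound : ∀ j k {t} → t ∈ expansions j k → Expansion k t × length t ≤ j
  expansions-sound j       zero    (here refl) = ([] , refl , tt) , z≤n
  expansions-sound (suc j) (suc k) t∈ with ∈-concatRange⁻ _ 0 (suc (suc k)) t∈
  ... | i , _ , t∈prefix with ∈-prefixDigit⁻ (expansions j) (suc k) i t∈prefix
  ...   | α , t′ , refl , α+ni≡k , α∈A , t′∈ with expansions-sound j i t′∈
  ...     | (digits , val≡i , ends) , length≤j =
    (α∈A ∷ digits , val≡ , EndsNonzero-∷ n α t′ ends val≡) , s≤s length≤j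
    where
    val≡ : val n (α ∷ t′) ≡ suc k
    val≡ = trans (val-∷ n α t′) (trans (cong (λ v → α + n * v) val≡i) α+ni≡k)

  expansions-complete : ∀ j k {t} → Expansion k t → length t ≤ j → t ∈ expansions j k
  expansions-complete j       zero    {[]}     _ _ = here refl
  expansions-complete j       zero    {α ∷ t′} (_ , val≡0 , ends) _ =
    contradiction val≡0 (>⇒≢ (val-positive α t′ ends))
  expansions-complete zero    (suc k) {α ∷ t′} _ ()
  expansions-complete (suc j) (suc k) {α ∷ t′} (α∈A ∷ digits , val≡ , ends) (s≤s length≤j) =
    ∈-concatRange⁺ (prefixDigit (expansions j) (suc k)) 0 (val n t′) (suc (suc k)) (s≤s i≤k)
      (∈-prefixDigit⁺ (expansions j) (suc k) (val n t′) α+ni≡k α∈A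
        (expansions-complete j (val n t′) (digits , refl , EndsNonzero-tail α t′ ends) length≤j))
    where
    α+ni≡k : α + n * val n t′ ≡ suc k
    α+ni≡k = trans (sym (val-∷ n α t′)) val≡
    i≤k : val n t′ ≤ suc k
    i≤k = ≤-trans (m≤n*m _ n) (subst (n * val n t′ ≤_) α+ni≡k (m≤n+m _ α))

  expansions-unique : ∀ j k → Unique (expansions j k)
  expansions-unique j       zero    = [] ∷ []
  expansions-unique zero    (suc k) = []
  expansions-unique (suc j) (suc k) =
    concatRange-unique _ tailValue tailValue-correct
      (λ i → prefixDigit-unique (expansions j) (suc k) i (expansions-unique j i)) 0 (suc (suc k))
    where
    tailValue : List ℕ → ℕ
    tailValue []      = 0
    tailValue (_ ∷ t) = val n t
    tailValue-correct : ∀ i {t} → t ∈ prefixDigit (expansions j) (suc k) i → tailValue t ≡ i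
    tailValue-correct i t∈ with ∈-prefixDigit⁻ (expansions j) (suc k) i t∈
    ... | _ , _ , refl , _ , _ , t′∈ = proj₁ (proj₂ (proj₁ (expansions-sound j i t′∈)))

  length-expansions-suc : 0 ∈A a → ∀ j k →
    length (expansions (suc j) k) ≡ sumRange 0 (suc k) (λ i → weight k i * length (expansions j i))
  length-expansions-suc 0∈A j zero    = sym (cong (_+ 0) (trans (*-identityʳ _) (weight-0-0 0∈A)))
  length-expansions-suc 0∈A j (suc k) =
    trans (length-concatRange (prefixDigit (expansions j) (suc k)) 0 (suc (suc k)))
          (sumRange-cong 0 (suc (suc k)) (length-prefixDigit (expansions j) (suc k)))

  ∈-expansions⇔ : ∀ j k → k < n ^ j → ∀ t → t ∈ expansions j k ⇔ IsExpansion n a k t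
  ∈-expansions⇔ j k k<nʲ t = mk⇔
    (λ t∈ → Equivalence.from (IsExpansion⇔Expansion k t) (proj₁ (expansions-sound j k t∈)))
    (λ isExp → let exp@(_ , val≡k , ends) = Equivalence.to (IsExpansion⇔Expansion k t) isExp in
      expansions-complete j k exp (val<n^j⇒length≤j j t ends (subst (_< n ^ j) (sym val≡k) k<nʲ)))

  expansions-card : ∀ j k → k < n ^ j → HasCard (IsExpansion n a k) (length (expansions j k))
  expansions-card j k k<nʲ = expansions j k , expansions-unique j k , ∈-expansions⇔ j k k<nʲ , refl

  Sʲδ-negative : ∀ j q → iter j (S n a) δ -[1+ q ] ≡ + 0
  Sʲδ-negative zero    q = refl
  Sʲδ-negative (suc j) q = S-negative (iter j (S n a) δ) (Sʲδ-negative j) q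

  Sʲδ≡length-expansions : 0 ∈A a → ∀ j k → iter j (S n a) δ (+ k) ≡ + length (expansions j k)
  Sʲδ≡length-expansions 0∈A zero    zero    = refl
  Sʲδ≡length-expansions 0∈A zero    (suc k) = refl
  Sʲδ≡length-expansions 0∈A (suc j) k       =
    trans (S-onℕ (iter j (S n a) δ) (λ i → length (expansions j i))
                 (Sʲδ-negative j) (Sʲδ≡length-expansions 0∈A j) k)
          (cong +_ (sym (length-expansions-suc 0∈A j k)))

theorem1 : (n : ℕ) → 2 ≤ n → (a : Fin n → ℕ)
    → (∀ (i : Fin n) → toℕ i ≡ 0 → a i ≡ 0)
    → (∀ (i j : Fin n) → toℕ i < toℕ j → a i < a j)
    → ∀ (j : ℕ) → 1 ≤ j → ∀ (k : ℕ) → k < n ^ j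
    → Σ ℕ λ m → HasCard (IsExpansion n a k) m × iter j (S n a) δ (+ k) ≡ + m
theorem1 (suc n′) _ a a₀≡0 _ j _ k k<nʲ =
  length (expansions j k) , expansions-card j k k<nʲ , Sʲδ≡length-expansions 0∈A j k
  where
  open Expansions (suc n′) a
  0∈A : 0 ∈A a
  0∈A = Fin.zero , a₀≡0 Fin.zero refl
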